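{- Let $m\geq n\geq 0$ and let $w$ be a word with $m$ letters $\mathsf{n}$ and $n$ letters $\mathsf{e}$, with associated partition $\lambda=\lambda(w)$ and conjugate partition $\lambda'$. Define $b(\lambda)=(b_1,\dots,b_n)$ by \[ b_i=\begin{cases} m+1-i-\lambda'_i & \text{if } \lambda_{m+1-i}<i,\\ i-\lambda_{m+1-i} & \text{if }\lambda_{m+1-i}\geq i.\end{cases} \] Then in $\mathscr{P}$, \[ w=\mathrm{wt}_{b_1}\mathrm{wt}_{b_2}\cdots\mathrm{wt}_{b_n}\cdot\mathsf{n}^{m-n}. \]
   Context: Let $q$ be an indeterminate. $\mathscr{P}$ denotes the noncommutative associative unital $\mathbb{C}(q)$-algebra generated by $\mathsf{n},\mathsf{e}$ subject to $(1+q)\,\mathsf{ene}=q\,\mathsf{een}+\mathsf{nee}$ and $(1+q)\,\mathsf{nen}=q\,\mathsf{enn}+\mathsf{nne}$. A word with $m$ letters $\mathsf{n}$ and $n$ letters $\mathsf{e}$ is identified with the lattice path from $(0,0)$ to $(n,m)$ read left to right ($\mathsf{n}$ = unit north step, $\mathsf{e}$ = unit east step); its partition $\lambda=\lambda(w)\subseteq m\times n$ is the set of cells of the $m\times n$ box (English notation, rows numbered $1,\dots,m$ from top) to the upper-left of the path, i.e. $\lambda_j$ is the number of letters $\mathsf{e}$ preceding the $(m+1-j)$-th letter $\mathsf{n}$ of $w$, for $1\leq j\leq m$. The conjugate is $\lambda'_i=\#\{j:\lambda_j\geq i\}$. For $j\geq 0$, $[j]_q=1+q+\cdots+q^{j-1}$.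 Set $\mathsf{s}=\mathsf{en}$, $\mathsf{t}=\mathsf{ne}$, and for $i\in\mathbb{Z}$ define $\mathrm{wt}_i\in\mathscr{P}$ by $\mathrm{wt}_i=[i]_q\,\mathsf{t}-q[i-1]_q\,\mathsf{s}$ if $i\geq 1$, and $\mathrm{wt}_i=q^{i}\left([1-i]_q\,\mathsf{s}-[-i]_q\,\mathsf{t}\right)$ if $i\leq 0$ (so $\mathrm{wt}_0=\mathsf{s}$, $\mathrm{wt}_1=\mathsf{t}$). -}

module Defs where

open import Level using (Level)
open import Data.Nat using (ℕ; zero; suc; _∸_; _≤ᵇ_; _<ᵇ_)
import Data.Nat as ℕ
open import Data.Integer using (ℤ; +_; -[1+_]; _⊖_)
open import Data.Bool using (if_then_else_)
open import Data.List using (List; []; _∷_; map; foldr; upTo)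
open import Algebra.Bundles using (Ring)

-- Letters of a word: 𝗻 = unit north step, 𝗲 = unit east step.
data Letter : Set where
  𝗻 𝗲 : Letter

Word : Set
Word = List Letter

count𝗻 : Word → ℕ
count𝗻 [] = 0
count𝗻 (𝗻 ∷ w) = suc (count𝗻 w)
count𝗻 (𝗲 ∷ w) = count𝗻 w

count𝗲 : Word → ℕ
count𝗲 [] = 0
count𝗲 (𝗻 ∷ w) = count𝗲 w
count𝗲 (𝗲 ∷ w) = suc (count𝗲 w)

eBefore : ℕ → Word → ℕ
eBefore zero w = 0
eBefore (suc k) [] = 0
eBefore (suc k) (𝗲 ∷ w) = suc (eBefore (suc k) w)
eBefore (suc zero) (𝗻 ∷ w) = 0
eBefore (suc (suc k)) (𝗻 ∷ w) = eBefore (suc k) w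

-- λ_j (1 ≤ j ≤ m) = number of 𝗲 preceding the (m+1-j)-th 𝗻 of w.
part : ℕ → Word → ℕ → ℕ
part m w j = eBefore (suc m ∸ j) w

countGE : (ℕ → ℕ) → ℕ → ℕ → ℕ
countGE f i zero = 0
countGE f i (suc k) = (if i ≤ᵇ f (suc k) then 1 else 0) ℕ.+ countGE f i k

conj : ℕ → Word → ℕ → ℕ
conj m w i = countGE (part m w) i m

bSeq : ℕ → Word → ℕ → ℤ
bSeq m w i =
  if part m w (suc m ∸ i) <ᵇ i
  then (suc m ∸ i) ⊖ conj m w i
  else i ⊖ part m w (suc m ∸ i)

bList : ℕ → ℕ → Word → List ℤ
bList m n w = map (λ i → bSeq m w (suc i)) (upTo n)

module _ {c ℓ : Level} (R : Ring c ℓ) where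
  open Ring R

  pow : Carrier → ℕ → Carrier
  pow x zero = 1#
  pow x (suc k) = x * pow x k

  qint : Carrier → ℕ → Carrier
  qint q zero = 0#
  qint q (suc j) = 1# + q * qint q j

  evalWord : Carrier → Carrier → Word → Carrier
  evalWord nn ee [] = 1#
  evalWord nn ee (𝗻 ∷ w) = nn * evalWord nn ee w
  evalWord nn ee (𝗲 ∷ w) = ee * evalWord nn ee w

  -- wt_i, with q⁻¹ = qinv, s = ee * nn, t = nn * ee
  -- wt_i = [i]_q t − q [i−1]_q s                   (i ≥ 1)
  -- wt_i = q^i ([1−i]_q s − [−i]_q t)               (i ≤ 0), q^i = qinv^(−i)
  wt : (q qinv nn ee : Carrier) → ℤ → Carrier
  wt q qinv nn ee (+ zero) =
    pow qinv 0 * (qint q 1 * (ee * nn) + - (qint q 0 * (nn * ee)))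
  wt q qinv nn ee (+ suc k) =
    qint q (suc k) * (nn * ee) + - (q * qint q k * (ee * nn))
  wt q qinv nn ee -[1+ k ] =
    pow qinv (suc k) * (qint q (suc (suc k)) * (ee * nn) + - (qint q (suc k) * (nn * ee)))

  wtProd : (q qinv nn ee : Carrier) → List ℤ → Carrier
  wtProd q qinv nn ee = foldr (λ i x → wt q qinv nn ee i * x) 1#

module Submission where

-- A word containing both letters begins with 𝗻ᵏ𝗲 (k ≥ 1) or with 𝗲ᵃ⁺¹𝗻 (a ≥ 0). The defining
-- relations give 𝗻 wt_k = wt_{k+1} 𝗻 and 𝗲 wt_{-a} = wt_{-a-1} 𝗲 (both come down to
-- [k+2]_q + q[k]_q = (1+q)[k+1]_q), hence 𝗻ᵏ𝗲 = wt_k 𝗻ᵏ⁻¹ and 𝗲ᵃ⁺¹𝗻 = wt_{-a} 𝗲ᵃ. So one weight,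
-- k resp. -a, is pulled to the front, and what remains is the word with its first 𝗻 and first 𝗲
-- deleted. On partitions this deletes the bottom row and the first column of λ; that pulled-out
-- weight is exactly b_1, while (b_2, …, b_n) becomes the b-sequence of the smaller word. Induction
-- on n ends at w = 𝗻ᵐ.

open import Defs
open import Level using (Level; _⊔_)
open import Data.Nat using (ℕ; _≤_; _∸_)
open import Data.List using (List; []; _∷_)
open import Relation.Binary.PropositionalEquality using (_≡_)
open import Algebra.Bundles using (Ring)

module LatticePaths where

  open import Data.Nat using (zero; suc; pred; _+_; _<_; _≤ᵇ_; _<ᵇ_; z≤n; s≤s; z<s; s<s)
  open import Data.Nat.Properties
    using ( ≤-refl; ≤-trans; ≤-<-trans; n≤1+n; m≤n⇒m≤1+n; <⇒≱; ≤ᵇ-reflects-≤; <ᵇ-reflects-<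
          ; m∸n≤m; m∸[m∸n]≡n; +-∸-assoc)
  open import Data.Integer using (ℤ; +_; -_; _⊖_)
  open import Data.Integer.Properties using ([1+m]⊖[1+n]≡m⊖n; ⊖-≥; ⊖-≤)
  open import Data.Bool using (true; false; if_then_else_)
  open import Function using (id; _∘_)
  open import Relation.Nullary using (contradiction)
  open import Relation.Nullary.Reflects using (ofʸ)
  open import Data.List using (map; upTo; applyUpTo)
  open import Data.List.Properties using (map-applyUpTo)
  open import Relation.Binary.PropositionalEquality
    using (refl; sym; trans; cong; cong₂; subst; module ≡-Reasoning)
  open ≡-Reasoning

  deleteFirst : Letter → Word → Word
  deleteFirst _ [] = []
  deleteFirst 𝗻 (𝗻 ∷ w) = w
  deleteFirst 𝗻 (𝗲 ∷ w) = 𝗲 ∷ deleteFirst 𝗻 w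
  deleteFirst 𝗲 (𝗲 ∷ w) = w
  deleteFirst 𝗲 (𝗻 ∷ w) = 𝗻 ∷ deleteFirst 𝗲 w

  -- λ(peel w) is λ(w) with its bottom row and its first column removed.
  peel : Word → Word
  peel w = deleteFirst 𝗲 (deleteFirst 𝗻 w)

  leading𝗻 : Word → ℕ
  leading𝗻 (𝗻 ∷ w) = suc (leading𝗻 w)
  leading𝗻 _ = 0

  leading𝗻≤count𝗻 : ∀ w → leading𝗻 w ≤ count𝗻 w
  leading𝗻≤count𝗻 [] = z≤n
  leading𝗻≤count𝗻 (𝗻 ∷ w) = s≤s (leading𝗻≤count𝗻 w)
  leading𝗻≤count𝗻 (𝗲 ∷ w) = z≤n

  count𝗻-deleteFirst-𝗻 : ∀ w → count𝗻 (deleteFirst 𝗻 w) ≡ pred (count𝗻 w)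
  count𝗻-deleteFirst-𝗻 [] = refl
  count𝗻-deleteFirst-𝗻 (𝗻 ∷ w) = refl
  count𝗻-deleteFirst-𝗻 (𝗲 ∷ w) = count𝗻-deleteFirst-𝗻 w

  count𝗻-deleteFirst-𝗲 : ∀ w → count𝗻 (deleteFirst 𝗲 w) ≡ count𝗻 w
  count𝗻-deleteFirst-𝗲 [] = refl
  count𝗻-deleteFirst-𝗲 (𝗻 ∷ w) = cong suc (count𝗻-deleteFirst-𝗲 w)
  count𝗻-deleteFirst-𝗲 (𝗲 ∷ w) = refl

  count𝗲-deleteFirst-𝗲 : ∀ w → count𝗲 (deleteFirst 𝗲 w) ≡ pred (count𝗲 w)
  count𝗲-deleteFirst-𝗲 [] = refl
  count𝗲-deleteFirst-𝗲 (𝗻 ∷ w) = count𝗲-deleteFirst-𝗲 w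
  count𝗲-deleteFirst-𝗲 (𝗲 ∷ w) = refl

  count𝗲-deleteFirst-𝗻 : ∀ w → count𝗲 (deleteFirst 𝗻 w) ≡ count𝗲 w
  count𝗲-deleteFirst-𝗻 [] = refl
  count𝗲-deleteFirst-𝗻 (𝗻 ∷ w) = refl
  count𝗲-deleteFirst-𝗻 (𝗲 ∷ w) = cong suc (count𝗲-deleteFirst-𝗻 w)

  count𝗻-peel : ∀ w → count𝗻 (peel w) ≡ pred (count𝗻 w)
  count𝗻-peel w = trans (count𝗻-deleteFirst-𝗲 (deleteFirst 𝗻 w)) (count𝗻-deleteFirst-𝗻 w)

  count𝗲-peel : ∀ w → count𝗲 (peel w) ≡ pred (count𝗲 w)
  count𝗲-peel w =
    trans (count𝗲-deleteFirst-𝗲 (deleteFirst 𝗻 w)) (cong pred (count𝗲-deleteFirst-𝗻 w))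

  eBefore-deleteFirst-𝗻 : ∀ j w → eBefore (suc j) (deleteFirst 𝗻 w) ≡ eBefore (suc (suc j)) w
  eBefore-deleteFirst-𝗻 j [] = refl
  eBefore-deleteFirst-𝗻 j (𝗻 ∷ w) = refl
  eBefore-deleteFirst-𝗻 j (𝗲 ∷ w) = cong suc (eBefore-deleteFirst-𝗻 j w)

  eBefore-deleteFirst-𝗲 : ∀ j w → eBefore (suc j) (deleteFirst 𝗲 w) ≡ pred (eBefore (suc j) w)
  eBefore-deleteFirst-𝗲 j [] = refl
  eBefore-deleteFirst-𝗲 j (𝗲 ∷ w) = refl
  eBefore-deleteFirst-𝗲 zero (𝗻 ∷ w) = refl
  eBefore-deleteFirst-𝗲 (suc j) (𝗻 ∷ w) = eBefore-deleteFirst-𝗲 j w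

  eBefore-peel : ∀ j w → eBefore (suc j) (peel w) ≡ pred (eBefore (suc (suc j)) w)
  eBefore-peel j [] = refl
  eBefore-peel j (𝗻 ∷ w) = eBefore-deleteFirst-𝗲 j w
  eBefore-peel j (𝗲 ∷ w) = eBefore-deleteFirst-𝗻 j w

  eBefore-1≤ : ∀ j w → eBefore 1 w ≤ eBefore (suc j) w
  eBefore-1≤ j [] = z≤n
  eBefore-1≤ j (𝗻 ∷ w) = z≤n
  eBefore-1≤ j (𝗲 ∷ w) = s≤s (eBefore-1≤ j w)

  part-reflect : ∀ m w {i} → i ≤ suc m → part m w (suc m ∸ i) ≡ eBefore i w
  part-reflect m w i≤1+m = cong (λ k → eBefore k w) (m∸[m∸n]≡n i≤1+m)

  part-below : ∀ m w {j} → j ≤ m → part (suc m) w j ≡ eBefore (suc (suc (m ∸ j))) w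
  part-below m w j≤m = cong (λ k → eBefore k w) (+-∸-assoc 2 j≤m)

  bSeq-eBefore : ∀ m w {i} → i ≤ suc m →
    bSeq m w i ≡ (if eBefore i w <ᵇ i then (suc m ∸ i) ⊖ conj m w i else i ⊖ eBefore i w)
  bSeq-eBefore m w {i} i≤1+m =
    cong (λ e → if e <ᵇ i then (suc m ∸ i) ⊖ conj m w i else i ⊖ e) (part-reflect m w i≤1+m)

  countGE-cong : ∀ f g i i′ M → (∀ j → j ≤ M → (i ≤ᵇ f j) ≡ (i′ ≤ᵇ g j)) →
    countGE f i M ≡ countGE g i′ M
  countGE-cong f g i i′ zero same = refl
  countGE-cong f g i i′ (suc M) same =
    cong₂ _+_ (cong (λ b → if b then 1 else 0) (same (suc M) ≤-refl))
              (countGE-cong f g i i′ M (λ j j≤M → same j (m≤n⇒m≤1+n j≤M)))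

  countGE-all : ∀ f i M → (∀ j → j ≤ M → (i ≤ᵇ f j) ≡ true) → countGE f i M ≡ M
  countGE-all f i zero all = refl
  countGE-all f i (suc M) all =
    cong₂ _+_ (cong (λ b → if b then 1 else 0) (all (suc M) ≤-refl))
              (countGE-all f i M (λ j j≤M → all j (m≤n⇒m≤1+n j≤M)))

  ≤ᵇ-pred : ∀ i e → (suc (suc i) ≤ᵇ e) ≡ (suc i ≤ᵇ pred e)
  ≤ᵇ-pred i zero = refl
  ≤ᵇ-pred i (suc e) = refl

  part-peel : ∀ m w {j} → j ≤ m → part m (peel w) j ≡ pred (part (suc m) w j)
  part-peel m w {j} j≤m = begin
    eBefore (suc m ∸ j) (peel w)           ≡⟨ cong (λ k → eBefore k (peel w)) (+-∸-assoc 1 j≤m) ⟩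
    eBefore (suc (m ∸ j)) (peel w)         ≡⟨ eBefore-peel (m ∸ j) w ⟩
    pred (eBefore (suc (suc (m ∸ j))) w)   ≡⟨ cong pred (part-below m w j≤m) ⟨
    pred (part (suc m) w j)                ∎

  part-𝗻∷ : ∀ m w {j} → j ≤ m → part (suc m) (𝗻 ∷ w) j ≡ part m w j
  part-𝗻∷ m w j≤m =
    trans (part-below m (𝗻 ∷ w) j≤m) (cong (λ k → eBefore k w) (sym (+-∸-assoc 1 j≤m)))

  >⇒≤ᵇ≡false : ∀ {i e} → e < i → (i ≤ᵇ e) ≡ false
  >⇒≤ᵇ≡false {i} {e} e<i with i ≤ᵇ e | ≤ᵇ-reflects-≤ i e
  ... | false | _ = refl
  ... | true | ofʸ i≤e = contradiction i≤e (<⇒≱ e<i)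

  conj-peel : ∀ m w i → eBefore (suc (suc i)) w < suc (suc i) →
    conj (suc m) w (suc (suc i)) ≡ conj m (peel w) (suc i)
  conj-peel m w i row< = cong₂ _+_ bottomRow otherRows
    where
    bottomRow : (if suc (suc i) ≤ᵇ part (suc m) w (suc m) then 1 else 0) ≡ 0
    bottomRow rewrite part-reflect (suc m) w {1} (s≤s z≤n)
                    | >⇒≤ᵇ≡false (≤-<-trans (eBefore-1≤ (suc i) w) row<) = refl
    otherRows : countGE (part (suc m) w) (suc (suc i)) m ≡ countGE (part m (peel w)) (suc i) m
    otherRows = countGE-cong _ _ _ _ m λ j j≤m →
      trans (≤ᵇ-pred i (part (suc m) w j)) (cong (suc i ≤ᵇ_) (sym (part-peel m w j≤m)))

  conj-𝗻∷ : ∀ m w i → conj (suc m) (𝗻 ∷ w) (suc i) ≡ conj m w (suc i)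
  conj-𝗻∷ m w i = cong₂ _+_ bottomRow otherRows
    where
    bottomRow : (if suc i ≤ᵇ part (suc m) (𝗻 ∷ w) (suc m) then 1 else 0) ≡ 0
    bottomRow rewrite part-reflect (suc m) (𝗻 ∷ w) {1} (s≤s z≤n) = refl
    otherRows : countGE (part (suc m) (𝗻 ∷ w)) (suc i) m ≡ countGE (part m w) (suc i) m
    otherRows = countGE-cong _ _ _ _ m λ j j≤m → cong (suc i ≤ᵇ_) (part-𝗻∷ m w j≤m)

  conj-𝗲∷ : ∀ m w → conj m (𝗲 ∷ w) 1 ≡ m
  conj-𝗲∷ m w = countGE-all _ 1 m λ j j≤m →
    cong (λ k → 1 ≤ᵇ eBefore k (𝗲 ∷ w)) (+-∸-assoc 1 j≤m)

  conj-1 : ∀ m w → 1 ≤ count𝗲 w → leading𝗻 w ≤ m → conj m w 1 ≡ m ∸ leading𝗻 w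
  conj-1 m (𝗲 ∷ w) _ _ = conj-𝗲∷ m w
  conj-1 (suc m) (𝗻 ∷ w) has𝗲 (s≤s lead≤m) = trans (conj-𝗻∷ m w 0) (conj-1 m w has𝗲 lead≤m)

  bSeq-peel : ∀ m w i → suc i ≤ m → bSeq (suc m) w (suc (suc i)) ≡ bSeq m (peel w) (suc i)
  bSeq-peel m w i i<m
    rewrite bSeq-eBefore (suc m) w (s≤s (s≤s (≤-trans (n≤1+n i) i<m)))
          | bSeq-eBefore m (peel w) (≤-trans i<m (n≤1+n m))
          | eBefore-peel i w
    with eBefore (suc (suc i)) w in row
  ... | zero = cong ((m ∸ i) ⊖_) (conj-peel m w i (subst (_< _) (sym row) z<s))
  ... | suc e with e <ᵇ suc i | <ᵇ-reflects-< e (suc i)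
  ...   | true  | ofʸ e<1+i = cong ((m ∸ i) ⊖_) (conj-peel m w i (subst (_< _) (sym row) (s<s e<1+i)))
  ...   | false | _         = [1+m]⊖[1+n]≡m⊖n (suc i) e

  bSeq-𝗻∷-1 : ∀ m w → 1 ≤ count𝗲 w → leading𝗻 w ≤ m → bSeq (suc m) (𝗻 ∷ w) 1 ≡ + suc (leading𝗻 w)
  bSeq-𝗻∷-1 m w has𝗲 lead≤m = begin
    bSeq (suc m) (𝗻 ∷ w) 1          ≡⟨ bSeq-eBefore (suc m) (𝗻 ∷ w) (s≤s z≤n) ⟩
    suc m ⊖ conj (suc m) (𝗻 ∷ w) 1  ≡⟨ cong (suc m ⊖_) (conj-1 (suc m) (𝗻 ∷ w) has𝗲 (s≤s lead≤m)) ⟩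
    suc m ⊖ (m ∸ leading𝗻 w)        ≡⟨ ⊖-≥ (≤-trans (m∸n≤m m (leading𝗻 w)) (n≤1+n m)) ⟩
    + (suc m ∸ (m ∸ leading𝗻 w))    ≡⟨ cong +_ (+-∸-assoc 1 (m∸n≤m m (leading𝗻 w))) ⟩
    + suc (m ∸ (m ∸ leading𝗻 w))    ≡⟨ cong (λ k → + suc k) (m∸[m∸n]≡n lead≤m) ⟩
    + suc (leading𝗻 w)              ∎

  bSeq-𝗲∷-1 : ∀ m w → bSeq m (𝗲 ∷ w) 1 ≡ - (+ eBefore 1 w)
  bSeq-𝗲∷-1 m w = begin
    bSeq m (𝗲 ∷ w) 1           ≡⟨ bSeq-eBefore m (𝗲 ∷ w) (s≤s z≤n) ⟩
    1 ⊖ suc (eBefore 1 w)      ≡⟨ [1+m]⊖[1+n]≡m⊖n 0 (eBefore 1 w) ⟩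
    0 ⊖ eBefore 1 w            ≡⟨ ⊖-≤ z≤n ⟩
    - (+ eBefore 1 w)          ∎

  applyUpTo-cong : ∀ {A : Set} {f g : ℕ → A} n → (∀ i → i < n → f i ≡ g i) →
    applyUpTo f n ≡ applyUpTo g n
  applyUpTo-cong zero f≗g = refl
  applyUpTo-cong (suc n) f≗g =
    cong₂ _∷_ (f≗g 0 z<s) (applyUpTo-cong n (λ i i<n → f≗g (suc i) (s<s i<n)))

  bList-peel : ∀ m n w → n ≤ m → bList (suc m) (suc n) w ≡ bSeq (suc m) w 1 ∷ bList m n (peel w)
  bList-peel m n w n≤m = cong (bSeq (suc m) w 1 ∷_) (begin
    map b (applyUpTo suc n)  ≡⟨ map-applyUpTo suc b n ⟩
    applyUpTo (b ∘ suc) n    ≡⟨ applyUpTo-cong n (λ i i<n → bSeq-peel m w i (≤-trans i<n n≤m)) ⟩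
    applyUpTo b′ n           ≡⟨ map-applyUpTo id b′ n ⟨
    map b′ (upTo n)          ∎)
    where
    b b′ : ℕ → ℤ
    b i = bSeq (suc m) w (suc i)
    b′ i = bSeq m (peel w) (suc i)

module _ {c ℓ : Level} (R : Ring c ℓ) where

  open Ring R
  open import Data.Nat using (zero; suc)
  open import Data.Integer using (ℤ; +_) renaming (-_ to -ℤ_)
  import Relation.Binary.PropositionalEquality as P
  open import Algebra.Properties.Ring R using (x[y-z]≈xy-xz; [y-z]x≈yx-zx)
  open import Algebra.Properties.Group +-group using (ε⁻¹≈ε)
  open import Relation.Binary.Reasoning.Setoid setoid

  Central : Carrier → Set (c ⊔ ℓ)
  Central a = ∀ x → a * x ≈ x * a

  central-0# : Central 0#
  central-0# x = trans (zeroˡ x) (sym (zeroʳ x))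

  central-1# : Central 1#
  central-1# x = trans (*-identityˡ x) (sym (*-identityʳ x))

  central-+ : ∀ {a b} → Central a → Central b → Central (a + b)
  central-+ {a} {b} a-central b-central x = begin
    (a + b) * x    ≈⟨ distribʳ x a b ⟩
    a * x + b * x  ≈⟨ +-cong (a-central x) (b-central x) ⟩
    x * a + x * b  ≈⟨ distribˡ x a b ⟨
    x * (a + b)    ∎

  central-* : ∀ {a b} → Central a → Central b → Central (a * b)
  central-* {a} {b} a-central b-central x = begin
    (a * b) * x  ≈⟨ *-assoc a b x ⟩
    a * (b * x)  ≈⟨ *-congˡ (b-central x) ⟩
    a * (x * b)  ≈⟨ *-assoc a x b ⟨
    (a * x) * b  ≈⟨ *-congʳ (a-central x) ⟩
    (x * a) * b  ≈⟨ *-assoc x a b ⟩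
    x * (a * b)  ∎

  central-pow : ∀ {a} → Central a → ∀ k → Central (pow R a k)
  central-pow a-central zero = central-1#
  central-pow a-central (suc k) = central-* a-central (central-pow a-central k)

  central-qint : ∀ {q} → Central q → ∀ k → Central (qint R q k)
  central-qint q-central zero = central-0#
  central-qint q-central (suc k) =
    central-+ central-1# (central-* q-central (central-qint q-central k))

  x[ay]≈a[xy] : ∀ {a} → Central a → ∀ x y → x * (a * y) ≈ a * (x * y)
  x[ay]≈a[xy] {a} a-central x y = begin
    x * (a * y)  ≈⟨ *-assoc x a y ⟨
    (x * a) * y  ≈⟨ *-congʳ (a-central x) ⟨
    (a * x) * y  ≈⟨ *-assoc a x y ⟩
    a * (x * y)  ∎

  x[ay-bz]≈a[xy]-b[xz] : ∀ {a b} → Central a → Central b → ∀ x y z →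
    x * (a * y - b * z) ≈ a * (x * y) - b * (x * z)
  x[ay-bz]≈a[xy]-b[xz] {a} {b} a-central b-central x y z = begin
    x * (a * y - b * z)            ≈⟨ x[y-z]≈xy-xz x (a * y) (b * z) ⟩
    x * (a * y) - x * (b * z)      ≈⟨ +-cong (x[ay]≈a[xy] a-central x y) (-‿cong (x[ay]≈a[xy] b-central x z)) ⟩
    a * (x * y) - b * (x * z)      ∎

  [ax-by]z≈a[xz]-b[yz] : ∀ a b x y z → (a * x - b * y) * z ≈ a * (x * z) - b * (y * z)
  [ax-by]z≈a[xz]-b[yz] a b x y z = begin
    (a * x - b * y) * z            ≈⟨ [y-z]x≈yx-zx z (a * x) (b * y) ⟩
    (a * x) * z - (b * y) * z      ≈⟨ +-cong (*-assoc a x z) (-‿cong (*-assoc b y z)) ⟩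
    a * (x * z) - b * (y * z)      ∎

  c[ax-by]≈[ca]x-[cb]y : ∀ c a b x y → c * (a * x - b * y) ≈ (c * a) * x - (c * b) * y
  c[ax-by]≈[ca]x-[cb]y c a b x y = begin
    c * (a * x - b * y)            ≈⟨ x[y-z]≈xy-xz c (a * x) (b * y) ⟩
    c * (a * x) - c * (b * y)      ≈⟨ +-cong (*-assoc c a x) (-‿cong (*-assoc c b y)) ⟨
    (c * a) * x - (c * b) * y      ∎

  1x-0y≈x : ∀ {a b} → a ≈ 1# → b ≈ 0# → ∀ x y → a * x - b * y ≈ x
  1x-0y≈x {a} {b} a≈1 b≈0 x y = begin
    a * x - b * y    ≈⟨ +-cong (*-congʳ a≈1) (-‿cong (*-congʳ b≈0)) ⟩
    1# * x - 0# * y  ≈⟨ +-cong (*-identityˡ x) (-‿cong (zeroˡ y)) ⟩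
    x - 0#           ≈⟨ +-congˡ ε⁻¹≈ε ⟩
    x + 0#           ≈⟨ +-identityʳ x ⟩
    x                ∎

  a+b≈c+d⇒b-d≈c-a : ∀ {a b c d} → a + b ≈ c + d → b - d ≈ c - a
  a+b≈c+d⇒b-d≈c-a {a} {b} {c} {d} a+b≈c+d = begin
    b - d                  ≈⟨ +-congʳ (-a+[a+b]≈b) ⟨
    (- a + (a + b)) - d    ≈⟨ +-congʳ (+-congˡ a+b≈c+d) ⟩
    (- a + (c + d)) - d    ≈⟨ +-assoc (- a) (c + d) (- d) ⟩
    - a + ((c + d) - d)    ≈⟨ +-congˡ (+-assoc c d (- d)) ⟩
    - a + (c + (d - d))    ≈⟨ +-congˡ (+-congˡ (-‿inverseʳ d)) ⟩
    - a + (c + 0#)         ≈⟨ +-congˡ (+-identityʳ c) ⟩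
    - a + c                ≈⟨ +-comm (- a) c ⟩
    c - a                  ∎
    where
    -a+[a+b]≈b : - a + (a + b) ≈ b
    -a+[a+b]≈b = trans (sym (+-assoc (- a) a b)) (trans (+-congʳ (-‿inverseˡ a)) (+-identityˡ b))

  pow-*-comm : ∀ x k → pow R x k * x ≈ x * pow R x k
  pow-*-comm x zero = central-1# x
  pow-*-comm x (suc k) = trans (*-assoc x (pow R x k) x) (*-congˡ (pow-*-comm x k))

  pow-inverse : ∀ {x y} → Central x → y * x ≈ 1# → ∀ k → pow R y k * pow R x k ≈ 1#
  pow-inverse x-central yx≈1 zero = *-identityˡ 1#
  pow-inverse {x} {y} x-central yx≈1 (suc k) = begin
    (y * yᵏ) * (x * xᵏ)  ≈⟨ *-assoc y yᵏ (x * xᵏ) ⟩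
    y * (yᵏ * (x * xᵏ))  ≈⟨ *-congˡ (x[ay]≈a[xy] x-central yᵏ xᵏ) ⟩
    y * (x * (yᵏ * xᵏ))  ≈⟨ *-assoc y x (yᵏ * xᵏ) ⟨
    (y * x) * (yᵏ * xᵏ)  ≈⟨ *-cong yx≈1 (pow-inverse x-central yx≈1 k) ⟩
    1# * 1#              ≈⟨ *-identityˡ 1# ⟩
    1#                   ∎
    where
    xᵏ yᵏ : Carrier
    xᵏ = pow R x k
    yᵏ = pow R y k

  module _ {q : Carrier} (q-central : Central q) where

    [k+2]+q[k]≈[k+1][1+q] : ∀ k →
      qint R q (suc (suc k)) + q * qint R q k ≈ qint R q (suc k) * (1# + q)
    [k+2]+q[k]≈[k+1][1+q] k = begin
      (1# + q * α) + q * β  ≈⟨ +-assoc 1# (q * α) (q * β) ⟩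
      1# + (q * α + q * β)  ≈⟨ +-congˡ (+-comm (q * α) (q * β)) ⟩
      1# + (q * β + q * α)  ≈⟨ +-assoc 1# (q * β) (q * α) ⟨
      α + q * α             ≈⟨ +-cong (*-identityʳ α) (sym (q-central α)) ⟨
      α * 1# + α * q        ≈⟨ distribˡ α 1# q ⟨
      α * (1# + q)          ∎
      where
      α β : Carrier
      α = qint R q (suc k)
      β = qint R q k

    qint-relation : ∀ k {X Y Z} → (1# + q) * Y ≈ q * X + Z →
      (q * qint R q (suc k)) * X + qint R q (suc k) * Z
        ≈ qint R q (suc (suc k)) * Y + (q * qint R q k) * Y
    qint-relation k {X} {Y} {Z} relation = begin
      (q * α) * X + α * Z        ≈⟨ +-congʳ (trans (*-congʳ (q-central α)) (*-assoc α q X)) ⟩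
      α * (q * X) + α * Z        ≈⟨ distribˡ α (q * X) Z ⟨
      α * (q * X + Z)            ≈⟨ *-congˡ relation ⟨
      α * ((1# + q) * Y)         ≈⟨ *-assoc α (1# + q) Y ⟨
      (α * (1# + q)) * Y         ≈⟨ *-congʳ ([k+2]+q[k]≈[k+1][1+q] k) ⟨
      (qint R q (suc (suc k)) + q * β) * Y  ≈⟨ distribʳ Y _ (q * β) ⟩
      qint R q (suc (suc k)) * Y + (q * β) * Y  ∎
      where
      α β : Carrier
      α = qint R q (suc k)
      β = qint R q k

  module Weights (q qinv nn ee : Carrier) (q-central : Central q) where

    W : ℤ → Carrier
    W = wt R q qinv nn ee

    s t : Carrier
    s = ee * nn
    t = nn * ee

    module _ (nen-relation : (1# + q) * (nn * ee * nn) ≈ q * (ee * nn * nn) + nn * nn * ee) where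

      nn-wt : ∀ k → nn * W (+ suc k) ≈ W (+ suc (suc k)) * nn
      nn-wt k = begin
        nn * (α * t - (q * β) * s)                  ≈⟨ x[ay-bz]≈a[xy]-b[xz] α-central qβ-central nn t s ⟩
        α * (nn * t) - (q * β) * (nn * s)           ≈⟨ a+b≈c+d⇒b-d≈c-a (qint-relation q-central k relation) ⟩
        [k+2] * (nn * s) - (q * α) * (s * nn)       ≈⟨ +-congʳ (*-congˡ (*-assoc nn ee nn)) ⟨
        [k+2] * (t * nn) - (q * α) * (s * nn)       ≈⟨ [ax-by]z≈a[xz]-b[yz] [k+2] (q * α) t s nn ⟨
        ([k+2] * t - (q * α) * s) * nn              ∎
        where
        α β [k+2] : Carrier
        α = qint R q (suc k)
        β = qint R q k
        [k+2] = qint R q (suc (suc k))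
        α-central : Central α
        α-central = central-qint q-central (suc k)
        qβ-central : Central (q * β)
        qβ-central = central-* q-central (central-qint q-central k)
        relation : (1# + q) * (nn * s) ≈ q * (s * nn) + nn * t
        relation = trans (*-congˡ (sym (*-assoc nn ee nn)))
                         (trans nen-relation (+-congˡ (*-assoc nn nn ee)))

      pow-nn-ee : ∀ k → pow R nn (suc k) * ee ≈ W (+ suc k) * pow R nn k
      pow-nn-ee zero = begin
        (nn * 1#) * ee  ≈⟨ *-congʳ (*-identityʳ nn) ⟩
        t               ≈⟨ 1x-0y≈x (trans (+-congˡ (zeroʳ q)) (+-identityʳ 1#)) (zeroʳ q) t s ⟨
        W (+ 1)         ≈⟨ *-identityʳ (W (+ 1)) ⟨
        W (+ 1) * 1#    ∎
      pow-nn-ee (suc k) = begin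
        (nn * nnᵏ⁺¹) * ee              ≈⟨ *-assoc nn nnᵏ⁺¹ ee ⟩
        nn * (nnᵏ⁺¹ * ee)              ≈⟨ *-congˡ (pow-nn-ee k) ⟩
        nn * (W (+ suc k) * nnᵏ)       ≈⟨ *-assoc nn (W (+ suc k)) nnᵏ ⟨
        (nn * W (+ suc k)) * nnᵏ       ≈⟨ *-congʳ (nn-wt k) ⟩
        (W (+ suc (suc k)) * nn) * nnᵏ ≈⟨ *-assoc (W (+ suc (suc k))) nn nnᵏ ⟩
        W (+ suc (suc k)) * nnᵏ⁺¹      ∎
        where
        nnᵏ nnᵏ⁺¹ : Carrier
        nnᵏ = pow R nn k
        nnᵏ⁺¹ = pow R nn (suc k)

    -- u a = q^a · wt_{-a}; the factor q^{-a} only enters at the very end.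
    u : ℕ → Carrier
    u a = qint R q (suc a) * s - qint R q a * t

    wt-neg : ∀ a → W (-ℤ (+ a)) P.≡ pow R qinv a * u a
    wt-neg zero = P.refl
    wt-neg (suc a) = P.refl

    module _ (ene-relation : (1# + q) * (ee * nn * ee) ≈ q * (ee * ee * nn) + nn * ee * ee) where

      q[ee·u]≈u·ee : ∀ a → q * (ee * u a) ≈ u (suc a) * ee
      q[ee·u]≈u·ee a = begin
        q * (ee * (α * s - β * t))             ≈⟨ *-congˡ (x[ay-bz]≈a[xy]-b[xz] α-central β-central ee s t) ⟩
        q * (α * (ee * s) - β * (ee * t))      ≈⟨ c[ax-by]≈[ca]x-[cb]y q α β (ee * s) (ee * t) ⟩
        (q * α) * (ee * s) - (q * β) * (ee * t) ≈⟨ a+b≈c+d⇒b-d≈c-a (trans (+-comm _ _) (qint-relation q-central a relation)) ⟩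
        [a+2] * (ee * t) - α * (t * ee)        ≈⟨ +-congʳ (*-congˡ (*-assoc ee nn ee)) ⟨
        [a+2] * (s * ee) - α * (t * ee)        ≈⟨ [ax-by]z≈a[xz]-b[yz] [a+2] α s t ee ⟨
        ([a+2] * s - α * t) * ee               ∎
        where
        α β [a+2] : Carrier
        α = qint R q (suc a)
        β = qint R q a
        [a+2] = qint R q (suc (suc a))
        α-central : Central α
        α-central = central-qint q-central (suc a)
        β-central : Central β
        β-central = central-qint q-central a
        relation : (1# + q) * (ee * t) ≈ q * (ee * s) + t * ee
        relation = trans (*-congˡ (sym (*-assoc ee nn ee)))
                         (trans ene-relation (+-congʳ (*-congˡ (*-assoc ee ee nn))))

      qᵃ[eeᵃ⁺¹nn]≈u·eeᵃ : ∀ a → pow R q a * (pow R ee (suc a) * nn) ≈ u a * pow R ee a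
      qᵃ[eeᵃ⁺¹nn]≈u·eeᵃ zero = begin
        1# * ((ee * 1#) * nn)  ≈⟨ *-identityˡ _ ⟩
        (ee * 1#) * nn         ≈⟨ *-congʳ (*-identityʳ ee) ⟩
        s                      ≈⟨ 1x-0y≈x (trans (+-congˡ (zeroʳ q)) (+-identityʳ 1#)) refl s t ⟨
        u 0                    ≈⟨ *-identityʳ (u 0) ⟨
        u 0 * 1#               ∎
      qᵃ[eeᵃ⁺¹nn]≈u·eeᵃ (suc a) = begin
        (q * qᵃ) * ((ee * eeᵃ⁺¹) * nn)  ≈⟨ *-assoc q qᵃ _ ⟩
        q * (qᵃ * ((ee * eeᵃ⁺¹) * nn))  ≈⟨ *-congˡ (*-congˡ (*-assoc ee eeᵃ⁺¹ nn)) ⟩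
        q * (qᵃ * (ee * (eeᵃ⁺¹ * nn)))  ≈⟨ *-congˡ (x[ay]≈a[xy] (central-pow q-central a) ee (eeᵃ⁺¹ * nn)) ⟨
        q * (ee * (qᵃ * (eeᵃ⁺¹ * nn)))  ≈⟨ *-congˡ (*-congˡ (qᵃ[eeᵃ⁺¹nn]≈u·eeᵃ a)) ⟩
        q * (ee * (u a * eeᵃ))          ≈⟨ *-congˡ (*-assoc ee (u a) eeᵃ) ⟨
        q * ((ee * u a) * eeᵃ)          ≈⟨ *-assoc q (ee * u a) eeᵃ ⟨
        (q * (ee * u a)) * eeᵃ          ≈⟨ *-congʳ (q[ee·u]≈u·ee a) ⟩
        (u (suc a) * ee) * eeᵃ          ≈⟨ *-assoc (u (suc a)) ee eeᵃ ⟩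
        u (suc a) * (ee * eeᵃ)          ∎
        where
        qᵃ eeᵃ eeᵃ⁺¹ : Carrier
        qᵃ = pow R q a
        eeᵃ = pow R ee a
        eeᵃ⁺¹ = pow R ee (suc a)

      pow-ee-nn : qinv * q ≈ 1# → ∀ a → pow R ee (suc a) * nn ≈ W (-ℤ (+ a)) * pow R ee a
      pow-ee-nn qinv-q a = begin
        X                                  ≈⟨ *-identityˡ X ⟨
        1# * X                             ≈⟨ *-congʳ (pow-inverse q-central qinv-q a) ⟨
        (pow R qinv a * pow R q a) * X     ≈⟨ *-assoc (pow R qinv a) (pow R q a) X ⟩
        pow R qinv a * (pow R q a * X)     ≈⟨ *-congˡ (qᵃ[eeᵃ⁺¹nn]≈u·eeᵃ a) ⟩
        pow R qinv a * (u a * pow R ee a)  ≈⟨ *-assoc (pow R qinv a) (u a) (pow R ee a) ⟨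
        (pow R qinv a * u a) * pow R ee a  ≈⟨ *-congʳ (reflexive (wt-neg a)) ⟨
        W (-ℤ (+ a)) * pow R ee a          ∎
        where
        X : Carrier
        X = pow R ee (suc a) * nn

  module _ (q qinv nn ee : Carrier) (q-central : Central q) (qinv-q : qinv * q ≈ 1#)
    (ene-relation : (1# + q) * (ee * nn * ee) ≈ q * (ee * ee * nn) + nn * ee * ee)
    (nen-relation : (1# + q) * (nn * ee * nn) ≈ q * (ee * nn * nn) + nn * nn * ee) where

    open Weights q qinv nn ee q-central
    open LatticePaths
      using (deleteFirst; peel; leading𝗻; leading𝗻≤count𝗻; count𝗻-peel; count𝗲-peel;
             bSeq-𝗻∷-1; bSeq-𝗲∷-1; bList-peel)
    open import Data.Nat using (pred; z≤n; s≤s)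
    import Data.Nat as ℕ
    import Data.Nat.Properties as ℕₚ

    ev : Word → Carrier
    ev = evalWord R nn ee

    pow-nn-ev : ∀ k w → 1 ≤ count𝗲 w →
      pow R nn (suc k) * ev w ≈ W (+ suc (leading𝗻 w ℕ.+ k)) * (pow R nn k * ev (deleteFirst 𝗲 w))
    pow-nn-ev k (𝗲 ∷ w) _ = begin
      pow R nn (suc k) * (ee * ev w)     ≈⟨ *-assoc (pow R nn (suc k)) ee (ev w) ⟨
      (pow R nn (suc k) * ee) * ev w     ≈⟨ *-congʳ (pow-nn-ee nen-relation k) ⟩
      (W (+ suc k) * pow R nn k) * ev w  ≈⟨ *-assoc (W (+ suc k)) (pow R nn k) (ev w) ⟩
      W (+ suc k) * (pow R nn k * ev w)  ∎
    pow-nn-ev k (𝗻 ∷ w) has𝗲 = begin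
      pow R nn (suc k) * (nn * ev w)                ≈⟨ *-assoc (pow R nn (suc k)) nn (ev w) ⟨
      (pow R nn (suc k) * nn) * ev w                ≈⟨ *-congʳ (pow-*-comm nn (suc k)) ⟩
      pow R nn (suc (suc k)) * ev w                 ≈⟨ pow-nn-ev (suc k) w has𝗲 ⟩
      W (+ suc (leading𝗻 w ℕ.+ suc k)) * (pow R nn (suc k) * rest)
        ≈⟨ *-cong (reflexive (P.cong (λ i → W (+ suc i)) (ℕₚ.+-suc (leading𝗻 w) k)))
                  (trans (*-congʳ (sym (pow-*-comm nn k))) (*-assoc (pow R nn k) nn rest)) ⟩
      W (+ suc (suc (leading𝗻 w ℕ.+ k))) * (pow R nn k * (nn * rest)) ∎
      where
      rest : Carrier
      rest = ev (deleteFirst 𝗲 w)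

    pow-ee-ev : ∀ a w → 1 ≤ count𝗻 w →
      pow R ee (suc a) * ev w ≈ W (-ℤ (+ (eBefore 1 w ℕ.+ a))) * (pow R ee a * ev (deleteFirst 𝗻 w))
    pow-ee-ev a (𝗻 ∷ w) _ = begin
      pow R ee (suc a) * (nn * ev w)          ≈⟨ *-assoc (pow R ee (suc a)) nn (ev w) ⟨
      (pow R ee (suc a) * nn) * ev w          ≈⟨ *-congʳ (pow-ee-nn ene-relation qinv-q a) ⟩
      (W (-ℤ (+ a)) * pow R ee a) * ev w      ≈⟨ *-assoc (W (-ℤ (+ a))) (pow R ee a) (ev w) ⟩
      W (-ℤ (+ a)) * (pow R ee a * ev w)      ∎
    pow-ee-ev a (𝗲 ∷ w) has𝗻 = begin
      pow R ee (suc a) * (ee * ev w)                ≈⟨ *-assoc (pow R ee (suc a)) ee (ev w) ⟨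
      (pow R ee (suc a) * ee) * ev w                ≈⟨ *-congʳ (pow-*-comm ee (suc a)) ⟩
      pow R ee (suc (suc a)) * ev w                 ≈⟨ pow-ee-ev (suc a) w has𝗻 ⟩
      W (-ℤ (+ (eBefore 1 w ℕ.+ suc a))) * (pow R ee (suc a) * rest)
        ≈⟨ *-cong (reflexive (P.cong (λ i → W (-ℤ (+ i))) (ℕₚ.+-suc (eBefore 1 w) a)))
                  (trans (*-congʳ (sym (pow-*-comm ee a))) (*-assoc (pow R ee a) ee rest)) ⟩
      W (-ℤ (+ suc (eBefore 1 w ℕ.+ a))) * (pow R ee a * (ee * rest)) ∎
      where
      rest : Carrier
      rest = ev (deleteFirst 𝗻 w)

    ev-peel : ∀ m w → count𝗻 w P.≡ suc m → 1 ≤ count𝗲 w →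
      ev w ≈ W (bSeq (suc m) w 1) * ev (peel w)
    ev-peel m (𝗻 ∷ w) count𝗻≡ has𝗲 = begin
      nn * ev w                                            ≈⟨ *-congʳ (*-identityʳ nn) ⟨
      pow R nn 1 * ev w                                    ≈⟨ pow-nn-ev 0 w has𝗲 ⟩
      W (+ suc (leading𝗻 w ℕ.+ 0)) * (1# * ev (peel (𝗻 ∷ w)))
        ≈⟨ *-cong (reflexive (P.cong (λ i → W (+ suc i)) (ℕₚ.+-identityʳ (leading𝗻 w)))) (*-identityˡ _) ⟩
      W (+ suc (leading𝗻 w)) * ev (peel (𝗻 ∷ w))          ≈⟨ *-congʳ (reflexive (P.cong W b₁)) ⟨
      W (bSeq (suc m) (𝗻 ∷ w) 1) * ev (peel (𝗻 ∷ w))      ∎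
      where
      b₁ : bSeq (suc m) (𝗻 ∷ w) 1 P.≡ + suc (leading𝗻 w)
      b₁ = bSeq-𝗻∷-1 m w has𝗲 (P.subst (leading𝗻 w ≤_) (ℕₚ.suc-injective count𝗻≡) (leading𝗻≤count𝗻 w))
    ev-peel m (𝗲 ∷ w) count𝗻≡ _ = begin
      ee * ev w                                            ≈⟨ *-congʳ (*-identityʳ ee) ⟨
      pow R ee 1 * ev w                                    ≈⟨ pow-ee-ev 0 w (P.subst (1 ≤_) (P.sym count𝗻≡) (s≤s z≤n)) ⟩
      W (-ℤ (+ (eBefore 1 w ℕ.+ 0))) * (1# * ev (peel (𝗲 ∷ w)))
        ≈⟨ *-cong (reflexive (P.cong (λ i → W (-ℤ (+ i))) (ℕₚ.+-identityʳ (eBefore 1 w)))) (*-identityˡ _) ⟩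
      W (-ℤ (+ eBefore 1 w)) * ev (peel (𝗲 ∷ w))          ≈⟨ *-congʳ (reflexive (P.cong W (bSeq-𝗲∷-1 (suc m) w))) ⟨
      W (bSeq (suc m) (𝗲 ∷ w) 1) * ev (peel (𝗲 ∷ w))      ∎

    ev-count𝗲≡0 : ∀ w → count𝗲 w P.≡ 0 → ev w ≈ pow R nn (count𝗻 w)
    ev-count𝗲≡0 [] _ = refl
    ev-count𝗲≡0 (𝗻 ∷ w) no𝗲 = *-congˡ (ev-count𝗲≡0 w no𝗲)

    evalWord≈wtProd : ∀ n m → n ≤ m → ∀ w → count𝗻 w P.≡ m → count𝗲 w P.≡ n →
      ev w ≈ wtProd R q qinv nn ee (bList m n w) * pow R nn (m ∸ n)
    evalWord≈wtProd zero m _ w count𝗻≡ count𝗲≡ = begin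
      ev w                 ≈⟨ ev-count𝗲≡0 w count𝗲≡ ⟩
      pow R nn (count𝗻 w)  ≡⟨ P.cong (pow R nn) count𝗻≡ ⟩
      pow R nn m           ≈⟨ *-identityˡ (pow R nn m) ⟨
      1# * pow R nn m      ∎
    evalWord≈wtProd (suc n) (suc m) (s≤s n≤m) w count𝗻≡ count𝗲≡ = begin
      ev w                                   ≈⟨ ev-peel m w count𝗻≡ (P.subst (1 ≤_) (P.sym count𝗲≡) (s≤s z≤n)) ⟩
      W b₁ * ev (peel w)                     ≈⟨ *-congˡ (evalWord≈wtProd n m n≤m (peel w) count𝗻-peel′ count𝗲-peel′) ⟩
      W b₁ * (Π (bList m n (peel w)) * nnᵐ⁻ⁿ)  ≈⟨ *-assoc (W b₁) (Π (bList m n (peel w))) nnᵐ⁻ⁿ ⟨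
      Π (b₁ ∷ bList m n (peel w)) * nnᵐ⁻ⁿ      ≡⟨ P.cong (λ bs → Π bs * nnᵐ⁻ⁿ) (bList-peel m n w n≤m) ⟨
      Π (bList (suc m) (suc n) w) * nnᵐ⁻ⁿ      ∎
      where
      Π : List ℤ → Carrier
      Π = wtProd R q qinv nn ee
      b₁ : ℤ
      b₁ = bSeq (suc m) w 1
      nnᵐ⁻ⁿ : Carrier
      nnᵐ⁻ⁿ = pow R nn (m ∸ n)
      count𝗻-peel′ : count𝗻 (peel w) P.≡ m
      count𝗻-peel′ = P.trans (count𝗻-peel w) (P.cong pred count𝗻≡)
      count𝗲-peel′ : count𝗲 (peel w) P.≡ n
      count𝗲-peel′ = P.trans (count𝗲-peel w) (P.cong pred count𝗲≡)

proposition3p12 : ∀ {c ℓ : Level} (R : Ring c ℓ) →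
    let open Ring R in
    (q qinv nn ee : Carrier) →
    (∀ x → q * x ≈ x * q) →
    q * qinv ≈ 1# → qinv * q ≈ 1# →
    (1# + q) * (ee * nn * ee) ≈ q * (ee * ee * nn) + nn * ee * ee →
    (1# + q) * (nn * ee * nn) ≈ q * (ee * nn * nn) + nn * nn * ee →
    (m n : ℕ) → n ≤ m → (w : Word) → count𝗻 w ≡ m → count𝗲 w ≡ n →
    evalWord R nn ee w
      ≈ wtProd R q qinv nn ee (bList m n w) * pow R nn (m ∸ n)
proposition3p12 R q qinv nn ee q-central _ qinv-q ene-relation nen-relation m n n≤m =
  evalWord≈wtProd R q qinv nn ee q-central qinv-q ene-relation nen-relation n m n≤m
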